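{- Let $b\ge0$ be an integer. If an edge labeling $t$ of $K_n$ is $b$-astray good, then $t$ is $\frac{b^2}{2}n$-almost supermagic.
   Context: $K_n$ is the complete graph on vertex set $V$, $|V|=n$, with edge set $E$; $\epsilon=\binom n2$; $[a]=\{1,\dots,a\}$, $[a,b]=\{a,\dots,b\}$. $D(v)$ is the set of edges containing $v$. An edge labeling is a bijection $t:E\to[\epsilon]$; for $F\subseteq E$, $S(t,F)=\{t(e):e\in F\}$, $s(t,F)=\sum_{e\in F}t(e)$, and $s(t,v)=s(t,D(v))$. $t$ is $\alpha$-almost supermagic if $|s(t,u)-s(t,v)|\le\alpha$ for all $u,v$. $t$ is $b$-astray good if there is a set $A\subseteq E$ (the astray part) such that: (1) with $a=|A|$, $a\equiv\epsilon\pmod 2$ and $S(t,A)=[\frac{\epsilon-a}2+1,\frac{\epsilon+a}2]$; (2) letting $L$ be the set of edges with $S(t,L)=[\frac{\epsilon-a}2]$ (the lower set) and $H=E\setminus(A\cup L)$ (the higher set), for every $v\in V$ one has $|D(v)\cap A|\le b$ and $|D(v)\cap L|=|D(v)\cap H|$; (3) for every $v\in V$, $s(t,D(v)\setminus A)=|D(v)\setminus A|\cdot(\epsilon+1)/2$. -}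

module Defs where

open import Data.Nat using (ℕ; zero; suc; _+_; _*_; _∸_; _≤_; _<_; _≡ᵇ_; _≤ᵇ_; ∣_-_∣)
open import Data.Nat.DivMod using (_/_; _%_)
open import Data.Bool using (Bool; true; false; if_then_else_; not; _∧_)
open import Data.Fin using (Fin)
import Data.Fin as F
open import Data.Fin.Properties using (<-cmp; _<?_)
open import Data.Product using (Σ; _×_; _,_; proj₁; proj₂; ∃)
open import Relation.Binary.Definitions using (tri<; tri≈; tri>)
open import Relation.Binary.PropositionalEquality using (_≡_)
open import Relation.Nullary using (yes; no)
open import Function.Definitions using (Injective)

sumFin : {n : ℕ} → (Fin n → ℕ) → ℕ
sumFin {zero}  f = 0
sumFin {suc n} f = f F.zero + sumFin (λ i → f (F.suc i))

-- Edges of K_n on vertex set Fin n: unordered pairs {i,j}, represented as i < j.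
Edge : ℕ → Set
Edge n = Σ (Fin n × Fin n) (λ p → proj₁ p F.< proj₂ p)

eps : ℕ → ℕ
eps n = (n * (n ∸ 1)) / 2

sumE : {n : ℕ} → (Edge n → ℕ) → ℕ
sumE {n} f = sumFin λ i → sumFin λ j → h i j (i <? j)
  where
  h : (i j : Fin n) → _ → ℕ
  h i j (yes p) = f ((i , j) , p)
  h i j (no _)  = 0

sumAt : {n : ℕ} → Fin n → (Edge n → ℕ) → ℕ
sumAt {n} v f = sumFin λ u → g u
  where
  g : Fin n → ℕ
  g u with <-cmp u v
  ... | tri< p _ _ = f ((u , v) , p)
  ... | tri≈ _ _ _ = 0
  ... | tri> _ _ p = f ((v , u) , p)

ind : Bool → ℕ
ind true  = 1
ind false = 0

IsEdgeLabeling : (n : ℕ) → (Edge n → ℕ) → Set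
IsEdgeLabeling n t =
  Injective _≡_ _≡_ t
  × (∀ e → 1 ≤ t e × t e ≤ eps n)
  × (∀ k → 1 ≤ k → k ≤ eps n → ∃ λ e → t e ≡ k)

sv : {n : ℕ} → (Edge n → ℕ) → Fin n → ℕ
sv t v = sumAt v t

-- t is (m/2)-almost supermagic, i.e. |s(t,u) - s(t,v)| ≤ m/2 for all u, v
-- (stated as 2 * |s(t,u) - s(t,v)| ≤ m to stay in ℕ).
HalfAlmostSupermagic : (n : ℕ) → (Edge n → ℕ) → ℕ → Set
HalfAlmostSupermagic n t m = ∀ (u v : Fin n) → 2 * ∣ sv t u - sv t v ∣ ≤ m

-- S(t,F) = [lo+1, hi] for F given as a Boolean predicate on edges.
ImageIsInterval : {n : ℕ} → (Edge n → ℕ) → (Edge n → Bool) → ℕ → ℕ → Set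
ImageIsInterval t F lo hi =
  (∀ e → F e ≡ true → lo < t e × t e ≤ hi)
  × (∀ k → lo < k → k ≤ hi → ∃ λ e → F e ≡ true × t e ≡ k)

module _ {n : ℕ} (t : Edge n → ℕ) (A : Edge n → Bool) where
  card : ℕ
  card = sumE (λ e → ind (A e))

  lowTop : ℕ
  lowTop = (eps n ∸ card) / 2

  -- the lower set L: the edges whose labels form [ (ε-a)/2 ] (t bijective)
  isL : Edge n → Bool
  isL e = t e ≤ᵇ lowTop

  isH : Edge n → Bool
  isH e = not (A e) ∧ not (isL e)

  AstrayGoodWith : ℕ → Set
  AstrayGoodWith b =
    (card % 2 ≡ eps n % 2)
    × ImageIsInterval t A lowTop ((eps n + card) / 2)
    × (∀ v → sumAt v (λ e → ind (A e)) ≤ b)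
    × (∀ v → sumAt v (λ e → ind (isL e)) ≡ sumAt v (λ e → ind (isH e)))
    -- (3)  s(t, D(v)\A) = |D(v)\A| (ε+1)/2, multiplied by 2
    × (∀ v → 2 * sumAt v (λ e → if A e then 0 else t e)
               ≡ sumAt v (λ e → ind (not (A e))) * (eps n + 1))

AstrayGood : (n : ℕ) → (Edge n → ℕ) → ℕ → Set
AstrayGood n t b = ∃ λ (A : Edge n → Bool) → AstrayGoodWith t A b

-- Condition (3) says that, off the astray part, every vertex sum is what it would be if all its
-- labels were the middle label (ε + 1)/2.  An astray label lies in [(ε - a)/2 + 1, (ε + a)/2], so
-- twice it is within a of ε + 1; hence 2 s(t,v) is within a·|D(v) ∩ A| ≤ ab of the common value
-- (n - 1)(ε + 1), and 2|s(t,u) - s(t,v)| ≤ 2ab.  Double counting the astray edges gives 2a ≤ bn.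

{-# OPTIONS --safe #-}
module Submission where

open import Defs
open import Data.Nat using (ℕ; zero; suc; pred; _+_; _*_; _∸_; _≤_; _<_; z≤n; s≤s⁻¹; ∣_-_∣)
open import Data.Nat.Properties
  using ( +-comm; +-identityʳ; *-comm; *-identityˡ; *-identityʳ; *-zeroʳ
        ; *-distribˡ-+; *-distribʳ-+; ≤-reflexive; ≤-trans; ≤-antisym; ≤-total
        ; +-mono-≤; +-monoˡ-≤; +-monoʳ-≤; *-monoˡ-≤; *-monoʳ-≤; m≤m+n; m≤n+m∸n; m≤n+o⇒m∸n≤o
        ; ∣-∣-comm; ∣-∣-triangle; ∣m+n-m+o∣≡∣n-o∣; *-distribˡ-∣-∣
        ; m≤n⇒∣m-n∣≡n∸m; m≤n⇒∣n-m∣≡n∸m; +-*-semiring; module ≤-Reasoning )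
open import Data.Nat.DivMod using (_/_; _%_; m≡m%n+[m/n]*n; m%n<n; m/n*n≤m)
open import Data.Nat.Tactic.RingSolver using (solve-∀)
open import Data.Bool using (Bool; true; false; if_then_else_; not)
open import Data.Fin using (Fin)
import Data.Fin as F
open import Data.Fin.Properties using (<-cmp; _<?_; <-irrefl; <-irrelevant; suc-injective)
open import Data.Product using (_,_; proj₁; proj₂; ∃)
open import Data.Sum using (inj₁; inj₂)
open import Data.Empty using (⊥-elim)
open import Function using (_∘_)
open import Data.Vec.Functional using (Vector)
open import Algebra.Properties.Semiring.Sum +-*-semiring
  using (sum; sum-cong-≗; ∑-distrib-+; ∑-comm; *-distribˡ-sum)
open import Relation.Binary.Definitions using (tri<; tri≈; tri>)
open import Relation.Binary.PropositionalEquality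
  using (_≡_; _≢_; refl; sym; trans; cong; cong₂; subst; subst₂; module ≡-Reasoning)
open import Relation.Nullary using (yes; no; ¬_)

sumFin≡sum : ∀ {n} (f : Vector ℕ n) → sumFin f ≡ sum f
sumFin≡sum {zero}  f = refl
sumFin≡sum {suc n} f = cong (f F.zero +_) (sumFin≡sum (λ i → f (F.suc i)))

sum-mono-≤ : ∀ {n} {f g : Vector ℕ n} → (∀ i → f i ≤ g i) → sum f ≤ sum g
sum-mono-≤ {zero}  f≤g = z≤n
sum-mono-≤ {suc n} f≤g = +-mono-≤ (f≤g F.zero) (sum-mono-≤ (λ i → f≤g (F.suc i)))

sum-const : ∀ n {x} → sum {n} (λ _ → x) ≡ n * x
sum-const zero    = refl
sum-const (suc n) = cong (_ +_) (sum-const n)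

∣m+n-o+p∣≤∣m-o∣+∣n-p∣ : ∀ m n o p → ∣ m + n - o + p ∣ ≤ ∣ m - o ∣ + ∣ n - p ∣
∣m+n-o+p∣≤∣m-o∣+∣n-p∣ m n o p = begin
  ∣ m + n - o + p ∣                   ≤⟨ ∣-∣-triangle (m + n) (o + n) (o + p) ⟩
  ∣ m + n - o + n ∣ + ∣ o + n - o + p ∣ ≡⟨ cong₂ _+_ (trans (cong₂ ∣_-_∣ (+-comm m n) (+-comm o n)) (∣m+n-m+o∣≡∣n-o∣ n m o))
                                                     (∣m+n-m+o∣≡∣n-o∣ o n p) ⟩
  ∣ m - o ∣ + ∣ n - p ∣                 ∎
  where open ≤-Reasoning

sum-∣-∣ : ∀ {n} (f g : Vector ℕ n) → ∣ sum f - sum g ∣ ≤ sum (λ i → ∣ f i - g i ∣)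
sum-∣-∣ {zero}  f g = z≤n
sum-∣-∣ {suc n} f g = ≤-trans (∣m+n-o+p∣≤∣m-o∣+∣n-p∣ (f F.zero) (sum f′) (g F.zero) (sum g′))
  (+-monoʳ-≤ ∣ f F.zero - g F.zero ∣ (sum-∣-∣ f′ g′))
  where
  f′ g′ : Vector ℕ n
  f′ i = f (F.suc i)
  g′ i = g (F.suc i)

sum-onesExcept : ∀ {n} (v : Fin n) (f : Vector ℕ n) →
  f v ≡ 0 → (∀ u → u ≢ v → f u ≡ 1) → suc (sum f) ≡ n
sum-onesExcept {suc n} F.zero f fv≡0 f≡1 = cong suc (begin
  f F.zero + sum (λ u → f (F.suc u)) ≡⟨ cong₂ _+_ fv≡0 (sum-cong-≗ (λ u → f≡1 (F.suc u) (λ ()))) ⟩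
  sum {n} (λ _ → 1)                  ≡⟨ trans (sum-const n) (*-identityʳ n) ⟩
  n                                  ∎)
  where open ≡-Reasoning
sum-onesExcept {suc n} (F.suc v) f fv≡0 f≡1 = begin
  suc (f F.zero + sum (λ u → f (F.suc u))) ≡⟨ cong (λ x → suc (x + sum (λ u → f (F.suc u)))) (f≡1 F.zero (λ ())) ⟩
  suc (suc (sum (λ u → f (F.suc u))))      ≡⟨ cong suc (sum-onesExcept v (λ u → f (F.suc u)) fv≡0 (λ u u≢v → f≡1 (F.suc u) (u≢v ∘ suc-injective))) ⟩
  suc n                                    ∎
  where open ≡-Reasoning

module _ {n : ℕ} where

  link : (Edge n → ℕ) → Fin n → Fin n → ℕ
  link f v u with <-cmp u v
  ... | tri< u<v _ _ = f ((u , v) , u<v)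
  ... | tri≈ _ _ _   = 0
  ... | tri> _ _ v<u = f ((v , u) , v<u)

  ordered : (Edge n → ℕ) → Fin n → Fin n → ℕ
  ordered f i j with i <? j
  ... | yes i<j = f ((i , j) , i<j)
  ... | no _    = 0

  -- The summands of sumAt and sumE are local to Defs; they are recovered
  -- here by unification, which makes them available for case analysis.
  sumAt≡sum : ∀ v f → sumAt v f ≡ sum (link f v)
  sumAt≡sum v f = trans (sumFin≡sum (proj₁ summand)) (sum-cong-≗ summand≗link)
    where
    summand : ∃ λ g → sumAt v f ≡ sumFin g
    summand = _ , refl
    summand≗link : ∀ u → proj₁ summand u ≡ link f v u
    summand≗link u with <-cmp u v
    ... | tri< _ _ _ = refl
    ... | tri≈ _ _ _ = refl
    ... | tri> _ _ _ = refl

  sumE≡sum : ∀ f → sumE f ≡ sum (λ i → sum (ordered f i))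
  sumE≡sum f = trans (sumFin≡sum (λ i → sumFin (proj₁ summand i)))
    (sum-cong-≗ λ i → trans (sumFin≡sum (proj₁ summand i)) (sum-cong-≗ (summand≗ordered i)))
    where
    summand : ∃ λ (g : Fin n → Fin n → ℕ) → sumE f ≡ sumFin (λ i → sumFin (g i))
    summand = _ , refl
    summand≗ordered : ∀ i j → proj₁ summand i j ≡ ordered f i j
    summand≗ordered i j with i <? j
    ... | yes _ = refl
    ... | no _  = refl

  ordered-< : ∀ f {i j} (i<j : i F.< j) → ordered f i j ≡ f ((i , j) , i<j)
  ordered-< f {i} {j} i<j with i <? j
  ... | yes i<j′ = cong (λ p → f ((i , j) , p)) (<-irrelevant i<j′ i<j)
  ... | no i≮j   = ⊥-elim (i≮j i<j)

  ordered-≮ : ∀ f {i j} → ¬ i F.< j → ordered f i j ≡ 0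
  ordered-≮ f {i} {j} i≮j with i <? j
  ... | yes i<j = ⊥-elim (i≮j i<j)
  ... | no _    = refl

  link≡ordered+ordered : ∀ f v u → link f v u ≡ ordered f u v + ordered f v u
  link≡ordered+ordered f v u with <-cmp u v
  ... | tri< u<v _ v≮u = sym (trans (cong₂ _+_ (ordered-< f u<v) (ordered-≮ f v≮u)) (+-identityʳ _))
  ... | tri≈ u≮v _ v≮u = sym (cong₂ _+_ (ordered-≮ f u≮v) (ordered-≮ f v≮u))
  ... | tri> u≮v _ v<u = sym (cong₂ _+_ (ordered-≮ f u≮v) (ordered-< f v<u))

  handshake : ∀ f → sum (λ v → sumAt v f) ≡ 2 * sumE f
  handshake f = begin
    sum (λ v → sumAt v f)                                 ≡⟨ sum-cong-≗ (λ v → trans (sumAt≡sum v f) (sum-cong-≗ (link≡ordered+ordered f v))) ⟩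
    sum (λ v → sum (λ u → ordered f u v + ordered f v u)) ≡⟨ sum-cong-≗ (λ v → ∑-distrib-+ (λ u → ordered f u v) (ordered f v)) ⟩
    sum (λ v → sum (λ u → ordered f u v) + S v)           ≡⟨ ∑-distrib-+ (λ v → sum (λ u → ordered f u v)) S ⟩
    sum (λ v → sum (λ u → ordered f u v)) + sum S         ≡⟨ cong (_+ sum S) (sym (∑-comm (ordered f))) ⟩
    sum S + sum S                                         ≡⟨ cong (sum S +_) (sym (+-identityʳ (sum S))) ⟩
    2 * sum S                                             ≡⟨ cong (2 *_) (sym (sumE≡sum f)) ⟩
    2 * sumE f                                            ∎
    where
    open ≡-Reasoning
    S : Vector ℕ n
    S i = sum (ordered f i)

  degree : ∀ v → suc (sumAt v (λ _ → 1)) ≡ n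
  degree v = trans (cong suc (sumAt≡sum v (λ _ → 1))) (sum-onesExcept v (link (λ _ → 1) v) no-loop edge-to-others)
    where
    no-loop : link (λ _ → 1) v v ≡ 0
    no-loop with <-cmp v v
    ... | tri< v<v _ _ = ⊥-elim (<-irrefl refl v<v)
    ... | tri≈ _ _ _   = refl
    ... | tri> _ _ v<v = ⊥-elim (<-irrefl refl v<v)
    edge-to-others : ∀ u → u ≢ v → link (λ _ → 1) v u ≡ 1
    edge-to-others u u≢v with <-cmp u v
    ... | tri< _ _ _   = refl
    ... | tri≈ _ u≡v _ = ⊥-elim (u≢v u≡v)
    ... | tri> _ _ _   = refl

  twice-sumE-≤ : ∀ {f b} → (∀ v → sumAt v f ≤ b) → 2 * sumE f ≤ n * b
  twice-sumE-≤ {f} {b} sumAt≤b = begin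
    2 * sumE f             ≡⟨ handshake f ⟨
    sum (λ v → sumAt v f)  ≤⟨ sum-mono-≤ sumAt≤b ⟩
    sum {n} (λ _ → b)      ≡⟨ sum-const n ⟩
    n * b                  ∎
    where open ≤-Reasoning

  link-map : ∀ (φ : ℕ → ℕ) → φ 0 ≡ 0 → ∀ f v u → link (λ e → φ (f e)) v u ≡ φ (link f v u)
  link-map φ φ0≡0 f v u with <-cmp u v
  ... | tri< _ _ _ = refl
  ... | tri≈ _ _ _ = sym φ0≡0
  ... | tri> _ _ _ = refl

  link-zipWith : ∀ (φ : ℕ → ℕ → ℕ) → φ 0 0 ≡ 0 →
    ∀ f g v u → link (λ e → φ (f e) (g e)) v u ≡ φ (link f v u) (link g v u)
  link-zipWith φ φ00≡0 f g v u with <-cmp u v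
  ... | tri< _ _ _ = refl
  ... | tri≈ _ _ _ = sym φ00≡0
  ... | tri> _ _ _ = refl

  link-mono-≤ : ∀ {f g} → (∀ e → f e ≤ g e) → ∀ v u → link f v u ≤ link g v u
  link-mono-≤ f≤g v u with <-cmp u v
  ... | tri< _ _ _ = f≤g _
  ... | tri≈ _ _ _ = z≤n
  ... | tri> _ _ _ = f≤g _

  sumAt-mono-≤ : ∀ v {f g} → (∀ e → f e ≤ g e) → sumAt v f ≤ sumAt v g
  sumAt-mono-≤ v {f} {g} f≤g = begin
    sumAt v f      ≡⟨ sumAt≡sum v f ⟩
    sum (link f v) ≤⟨ sum-mono-≤ (link-mono-≤ f≤g v) ⟩
    sum (link g v) ≡⟨ sumAt≡sum v g ⟨
    sumAt v g      ∎
    where open ≤-Reasoning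

  sumAt-cong : ∀ v {f g} → (∀ e → f e ≡ g e) → sumAt v f ≡ sumAt v g
  sumAt-cong v f≡g = ≤-antisym (sumAt-mono-≤ v (≤-reflexive ∘ f≡g)) (sumAt-mono-≤ v (≤-reflexive ∘ sym ∘ f≡g))

  sumAt-distrib-+ : ∀ v f g → sumAt v (λ e → f e + g e) ≡ sumAt v f + sumAt v g
  sumAt-distrib-+ v f g = begin
    sumAt v (λ e → f e + g e)               ≡⟨ sumAt≡sum v _ ⟩
    sum (link (λ e → f e + g e) v)          ≡⟨ sum-cong-≗ (link-zipWith _+_ refl f g v) ⟩
    sum (λ u → link f v u + link g v u)     ≡⟨ ∑-distrib-+ (link f v) (link g v) ⟩
    sum (link f v) + sum (link g v)         ≡⟨ cong₂ _+_ (sumAt≡sum v f) (sumAt≡sum v g) ⟨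
    sumAt v f + sumAt v g                   ∎
    where open ≡-Reasoning

  sumAt-distribˡ-* : ∀ v c f → sumAt v (λ e → c * f e) ≡ c * sumAt v f
  sumAt-distribˡ-* v c f = begin
    sumAt v (λ e → c * f e)      ≡⟨ sumAt≡sum v _ ⟩
    sum (link (λ e → c * f e) v) ≡⟨ sum-cong-≗ (link-map (c *_) (*-zeroʳ c) f v) ⟩
    sum (λ u → c * link f v u)   ≡⟨ *-distribˡ-sum c (link f v) ⟨
    c * sum (link f v)           ≡⟨ cong (c *_) (sumAt≡sum v f) ⟨
    c * sumAt v f                ∎
    where open ≡-Reasoning

  sumAt-distribʳ-* : ∀ v c f → sumAt v (λ e → f e * c) ≡ sumAt v f * c
  sumAt-distribʳ-* v c f = begin
    sumAt v (λ e → f e * c) ≡⟨ sumAt-cong v (λ e → *-comm (f e) c) ⟩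
    sumAt v (λ e → c * f e) ≡⟨ sumAt-distribˡ-* v c f ⟩
    c * sumAt v f           ≡⟨ *-comm c (sumAt v f) ⟩
    sumAt v f * c           ∎
    where open ≡-Reasoning

  sumAt-∣-∣ : ∀ v f g → ∣ sumAt v f - sumAt v g ∣ ≤ sumAt v (λ e → ∣ f e - g e ∣)
  sumAt-∣-∣ v f g = begin
    ∣ sumAt v f - sumAt v g ∣           ≡⟨ cong₂ ∣_-_∣ (sumAt≡sum v f) (sumAt≡sum v g) ⟩
    ∣ sum (link f v) - sum (link g v) ∣ ≤⟨ sum-∣-∣ (link f v) (link g v) ⟩
    sum (λ u → ∣ link f v u - link g v u ∣) ≡⟨ sum-cong-≗ (link-zipWith ∣_-_∣ refl f g v) ⟨
    sum (link (λ e → ∣ f e - g e ∣) v)  ≡⟨ sumAt≡sum v _ ⟨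
    sumAt v (λ e → ∣ f e - g e ∣)       ∎
    where open ≤-Reasoning

m≤n+o⇒n≤m+o⇒∣m-n∣≤o : ∀ {m n o} → m ≤ n + o → n ≤ m + o → ∣ m - n ∣ ≤ o
m≤n+o⇒n≤m+o⇒∣m-n∣≤o {m} {n} m≤n+o n≤m+o with ≤-total m n
... | inj₁ m≤n = subst (_≤ _) (sym (m≤n⇒∣m-n∣≡n∸m m≤n)) (m≤n+o⇒m∸n≤o n m n≤m+o)
... | inj₂ n≤m = subst (_≤ _) (sym (m≤n⇒∣n-m∣≡n∸m n≤m)) (m≤n+o⇒m∸n≤o m n m≤n+o)

∣2x-[m+1]∣≤a : ∀ m a x → (m ∸ a) / 2 < x → x ≤ (m + a) / 2 → ∣ 2 * x - (m + 1) ∣ ≤ a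
∣2x-[m+1]∣≤a m a x lo<x x≤hi = m≤n+o⇒n≤m+o⇒∣m-n∣≤o upper lower
  where
  open ≤-Reasoning
  k : ℕ
  k = m ∸ a
  upper : 2 * x ≤ m + 1 + a
  upper = begin
    2 * x             ≤⟨ *-monoʳ-≤ 2 x≤hi ⟩
    2 * ((m + a) / 2) ≡⟨ *-comm 2 ((m + a) / 2) ⟩
    (m + a) / 2 * 2   ≤⟨ m/n*n≤m (m + a) 2 ⟩
    m + a             ≤⟨ +-monoˡ-≤ a (m≤m+n m 1) ⟩
    m + 1 + a         ∎
  lower : m + 1 ≤ 2 * x + a
  lower = begin
    m + 1                   ≤⟨ +-monoˡ-≤ 1 (m≤n+m∸n m a) ⟩
    a + k + 1               ≤⟨ +-monoˡ-≤ 1 (+-monoʳ-≤ a (begin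
                                 k                 ≡⟨ m≡m%n+[m/n]*n k 2 ⟩
                                 k % 2 + k / 2 * 2 ≤⟨ +-monoˡ-≤ (k / 2 * 2) (s≤s⁻¹ (m%n<n k 2)) ⟩
                                 1 + k / 2 * 2     ∎)) ⟩
    a + (1 + k / 2 * 2) + 1 ≡⟨ a+[1+y*2]+1≡2*[1+y]+a a (k / 2) ⟩
    2 * suc (k / 2) + a     ≤⟨ +-monoˡ-≤ a (*-monoʳ-≤ 2 lo<x) ⟩
    2 * x + a               ∎
    where
    a+[1+y*2]+1≡2*[1+y]+a : ∀ a y → a + (1 + y * 2) + 1 ≡ 2 * suc y + a
    a+[1+y*2]+1≡2*[1+y]+a = solve-∀

module _ {n : ℕ} (t : Edge n → ℕ) (A : Edge n → Bool) where

  private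
    E a : ℕ
    E = eps n
    a = card t A

  isAstray isRegular : Edge n → ℕ
  isAstray e = ind (A e)
  isRegular e = ind (not (A e))

  astrayLabel regularLabel : Edge n → ℕ
  astrayLabel e = if A e then t e else 0
  regularLabel e = if A e then 0 else t e

  astrayLabel-near-middle : ImageIsInterval t A (lowTop t A) ((E + a) / 2) →
    ∀ e → ∣ 2 * astrayLabel e - isAstray e * (E + 1) ∣ ≤ isAstray e * a
  astrayLabel-near-middle (inA⇒inWindow , _) e with A e in Ae
  ... | false = z≤n
  ... | true  = subst₂ (λ c d → ∣ 2 * t e - c ∣ ≤ d) (sym (*-identityˡ (E + 1))) (sym (*-identityˡ a))
                       (∣2x-[m+1]∣≤a E a (t e) (proj₁ (inA⇒inWindow e Ae)) (proj₂ (inA⇒inWindow e Ae)))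

  twice-sumAt-astrayLabel-near-middle : ImageIsInterval t A (lowTop t A) ((E + a) / 2) →
    ∀ w → ∣ 2 * sumAt w astrayLabel - sumAt w isAstray * (E + 1) ∣ ≤ sumAt w isAstray * a
  twice-sumAt-astrayLabel-near-middle window w = begin
    ∣ 2 * sumAt w astrayLabel - sumAt w isAstray * (E + 1) ∣
      ≡⟨ cong₂ ∣_-_∣ (sumAt-distribˡ-* w 2 astrayLabel) (sumAt-distribʳ-* w (E + 1) isAstray) ⟨
    ∣ sumAt w (λ e → 2 * astrayLabel e) - sumAt w (λ e → isAstray e * (E + 1)) ∣
      ≤⟨ sumAt-∣-∣ w _ _ ⟩
    sumAt w (λ e → ∣ 2 * astrayLabel e - isAstray e * (E + 1) ∣)
      ≤⟨ sumAt-mono-≤ w (astrayLabel-near-middle window) ⟩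
    sumAt w (λ e → isAstray e * a)
      ≡⟨ sumAt-distribʳ-* w a isAstray ⟩
    sumAt w isAstray * a
      ∎
    where open ≤-Reasoning

  twice-sv-split : (∀ v → 2 * sumAt v regularLabel ≡ sumAt v isRegular * (E + 1)) →
    ∀ w → 2 * sv t w ≡ sumAt w isRegular * (E + 1) + 2 * sumAt w astrayLabel
  twice-sv-split balanced w = begin
    2 * sv t w                                          ≡⟨ cong (2 *_) (sumAt-cong w label-split) ⟩
    2 * sumAt w (λ e → regularLabel e + astrayLabel e)  ≡⟨ cong (2 *_) (sumAt-distrib-+ w regularLabel astrayLabel) ⟩
    2 * (sumAt w regularLabel + sumAt w astrayLabel)    ≡⟨ *-distribˡ-+ 2 (sumAt w regularLabel) (sumAt w astrayLabel) ⟩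
    2 * sumAt w regularLabel + 2 * sumAt w astrayLabel  ≡⟨ cong (_+ 2 * sumAt w astrayLabel) (balanced w) ⟩
    sumAt w isRegular * (E + 1) + 2 * sumAt w astrayLabel ∎
    where
    open ≡-Reasoning
    label-split : ∀ e → t e ≡ regularLabel e + astrayLabel e
    label-split e with A e
    ... | true  = refl
    ... | false = sym (+-identityʳ (t e))

  pred≡regular+astray : ∀ w → pred n ≡ sumAt w isRegular + sumAt w isAstray
  pred≡regular+astray w = begin
    pred n                                  ≡⟨ cong pred (degree w) ⟨
    sumAt w (λ _ → 1)                       ≡⟨ sumAt-cong w one-split ⟩
    sumAt w (λ e → isRegular e + isAstray e) ≡⟨ sumAt-distrib-+ w isRegular isAstray ⟩
    sumAt w isRegular + sumAt w isAstray    ∎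
    where
    open ≡-Reasoning
    one-split : ∀ e → 1 ≡ isRegular e + isAstray e
    one-split e with A e
    ... | true  = refl
    ... | false = refl

  twice-sv-near-middle : ImageIsInterval t A (lowTop t A) ((E + a) / 2) →
    (∀ v → 2 * sumAt v regularLabel ≡ sumAt v isRegular * (E + 1)) →
    ∀ w → ∣ 2 * sv t w - pred n * (E + 1) ∣ ≤ sumAt w isAstray * a
  twice-sv-near-middle window balanced w = begin
    ∣ 2 * sv t w - pred n * (E + 1) ∣
      ≡⟨ cong₂ ∣_-_∣ (twice-sv-split balanced w)
                     (trans (cong (_* (E + 1)) (pred≡regular+astray w)) (*-distribʳ-+ (E + 1) r d)) ⟩
    ∣ r * (E + 1) + 2 * sumAt w astrayLabel - (r * (E + 1) + d * (E + 1)) ∣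
      ≡⟨ ∣m+n-m+o∣≡∣n-o∣ (r * (E + 1)) (2 * sumAt w astrayLabel) (d * (E + 1)) ⟩
    ∣ 2 * sumAt w astrayLabel - d * (E + 1) ∣
      ≤⟨ twice-sumAt-astrayLabel-near-middle window w ⟩
    d * a
      ∎
    where
    open ≤-Reasoning
    r d : ℕ
    r = sumAt w isRegular
    d = sumAt w isAstray

lemma6p5 : (n b : ℕ) (t : Edge n → ℕ) → IsEdgeLabeling n t → AstrayGood n t b
    → HalfAlmostSupermagic n t (b * b * n)
lemma6p5 n b t _ (A , _ , window , astray≤b , _ , balanced) u v = begin
  2 * ∣ sv t u - sv t v ∣                 ≡⟨ *-distribˡ-∣-∣ 2 (sv t u) (sv t v) ⟩
  ∣ 2 * sv t u - 2 * sv t v ∣             ≤⟨ ∣-∣-triangle (2 * sv t u) c (2 * sv t v) ⟩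
  ∣ 2 * sv t u - c ∣ + ∣ c - 2 * sv t v ∣ ≤⟨ +-mono-≤ (near u) (subst (_≤ d v * a) (∣-∣-comm (2 * sv t v) c) (near v)) ⟩
  d u * a + d v * a                       ≤⟨ +-mono-≤ (*-monoˡ-≤ a (astray≤b u)) (*-monoˡ-≤ a (astray≤b v)) ⟩
  b * a + b * a                           ≡⟨ b*a+b*a≡b*[2*a] a b ⟩
  b * (2 * a)                             ≤⟨ *-monoʳ-≤ b (twice-sumE-≤ astray≤b) ⟩
  b * (n * b)                             ≡⟨ b*[n*b]≡b*b*n n b ⟩
  b * b * n                               ∎
  where
  open ≤-Reasoning
  a c : ℕ
  a = card t A
  c = pred n * (eps n + 1)
  d : Fin n → ℕ
  d w = sumAt w (isAstray t A)
  near : ∀ w → ∣ 2 * sv t w - c ∣ ≤ d w * a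
  near = twice-sv-near-middle t A window balanced
  b*a+b*a≡b*[2*a] : ∀ a b → b * a + b * a ≡ b * (2 * a)
  b*a+b*a≡b*[2*a] = solve-∀
  b*[n*b]≡b*b*n : ∀ n b → b * (n * b) ≡ b * b * n
  b*[n*b]≡b*b*n = solve-∀
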